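{- For every positive integer $L$, \[ \sum_{s=1}^{L}\frac{q^{2s+1}}{(q^s;q)_{L+2-s}} = 1-\frac{q}{1-q^{L+1}}+\frac{2q-1}{(q;q)_{L+1}}. \]
   Context: $(a;q)_n=\prod_{i=0}^{n-1}(1-aq^i)$. -}

module Defs where

open import Data.Nat using (ℕ; zero; suc)
open import Data.Rational using (ℚ; 0ℚ; 1ℚ; _+_; _*_; _-_; 1/_; ≢-nonZero)
open import Data.Rational.Properties using (_≟_)
open import Relation.Nullary using (yes; no)

infixr 8 _^_
_^_ : ℚ → ℕ → ℚ
x ^ zero  = 1ℚ
x ^ suc n = x * (x ^ n)

-- q-Pochhammer symbol (a;q)_n = ∏_{i=0}^{n-1} (1 - a q^i)
poch : ℚ → ℚ → ℕ → ℚ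
poch a q zero    = 1ℚ
poch a q (suc n) = poch a q n * (1ℚ - a * (q ^ n))

-- total reciprocal (1/0 := 0); only ever applied to nonzero values under the
-- hypotheses of the theorem
inv : ℚ → ℚ
inv x with x ≟ 0ℚ
... | yes _  = 0ℚ
... | no x≢0 = 1/_ x {{≢-nonZero x≢0}}

infixl 7 _÷_
_÷_ : ℚ → ℚ → ℚ
x ÷ y = x * inv y

sumFrom1 : ℕ → (ℕ → ℚ) → ℚ
sumFrom1 zero    f = 0ℚ
sumFrom1 (suc n) f = sumFrom1 n f + f (suc n)

module Submission where

-- The splitting
--   (q;q)ₜ · (q^(t+1);q)_(N-t) = (q;q)_N          (t ≤ N)
-- turns every summand into q^(2s+1) (q;q)_(s-1) / (q;q)_(L+1), so after
-- pulling out the common denominator the theorem reduces to the polynomial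
-- identity
--   Σ_{s=1}^{L} q^(2s+1) (q;q)_(s-1) = (q;q)_(L+1) - q (q;q)_L + 2q - 1,
-- which holds by induction on L (each step is a ring identity).  Dividing by
-- (q;q)_(L+1), which is nonzero because no q^i (1 ≤ i ≤ L+1) equals 1, and
-- using 1/(1 - q^(L+1)) = (q;q)_L / (q;q)_(L+1) gives the right-hand side.

open import Defs
open import Data.Nat using (ℕ; zero; suc; _∸_; _≤_; z≤n; s≤s) renaming (_+_ to _+ℕ_; _*_ to _*ℕ_)
import Data.Nat.Properties as ℕ
open import Data.Rational using (ℚ; 0ℚ; 1ℚ; _+_; _*_; _-_; ≢-nonZero)
open import Data.Rational.Properties
  using (_≟_; 1≢0; *-inverseʳ; *-comm; *-assoc; *-identityʳ; *-identityˡ; *-zeroʳ; *-zeroˡ)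
open import Data.Rational.Solver using (module +-*-Solver)
open +-*-Solver using (solve; _:=_; con; _:+_; _:*_; _:-_)
open import Relation.Nullary using (yes; no)
open import Relation.Binary.PropositionalEquality
open import Data.Empty using (⊥-elim)

open ≡-Reasoning


inv-inverseʳ : ∀ x → x ≢ 0ℚ → x * inv x ≡ 1ℚ
inv-inverseʳ x x≢0 with x ≟ 0ℚ
... | yes x≡0 = ⊥-elim (x≢0 x≡0)
... | no x≢0′ = *-inverseʳ x {{≢-nonZero x≢0′}}

inv-unique : ∀ a b → a * b ≡ 1ℚ → inv a ≡ b
inv-unique a b ab≡1 = begin
  inv a              ≡⟨ sym (*-identityʳ (inv a)) ⟩
  inv a * 1ℚ         ≡⟨ cong (inv a *_) (sym ab≡1) ⟩
  inv a * (a * b)    ≡⟨ sym (*-assoc (inv a) a b) ⟩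
  (inv a * a) * b    ≡⟨ cong (_* b) (trans (*-comm (inv a) a) (inv-inverseʳ a a≢0)) ⟩
  1ℚ * b             ≡⟨ *-identityˡ b ⟩
  b                  ∎
  where
  a≢0 : a ≢ 0ℚ
  a≢0 a≡0 = 1≢0 (trans (sym ab≡1) (trans (cong (_* b) a≡0) (*-zeroˡ b)))

*-nonZero : ∀ a b → a ≢ 0ℚ → b ≢ 0ℚ → a * b ≢ 0ℚ
*-nonZero a b a≢0 b≢0 ab≡0 = b≢0 (begin
  b                  ≡⟨ sym (*-identityˡ b) ⟩
  1ℚ * b             ≡⟨ cong (_* b) (sym (trans (*-comm (inv a) a) (inv-inverseʳ a a≢0))) ⟩
  (inv a * a) * b    ≡⟨ *-assoc (inv a) a b ⟩
  inv a * (a * b)    ≡⟨ cong (inv a *_) ab≡0 ⟩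
  inv a * 0ℚ         ≡⟨ *-zeroʳ (inv a) ⟩
  0ℚ                 ∎)

one-minus-nonZero : ∀ x → x ≢ 1ℚ → 1ℚ - x ≢ 0ℚ
one-minus-nonZero x x≢1 1-x≡0 = x≢1 (begin
  x                  ≡⟨ solve 1 (λ x → x := con 1ℚ :- (con 1ℚ :- x)) refl x ⟩
  1ℚ - (1ℚ - x)      ≡⟨ cong (1ℚ -_) 1-x≡0 ⟩
  1ℚ                 ∎)

inv-via-product : ∀ a b c → a * b ≡ c → c ≢ 0ℚ → inv a ≡ b * inv c
inv-via-product a b c ab≡c c≢0 = inv-unique a (b * inv c) (begin
  a * (b * inv c)    ≡⟨ sym (*-assoc a b (inv c)) ⟩
  (a * b) * inv c    ≡⟨ cong (_* inv c) ab≡c ⟩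
  c * inv c          ≡⟨ inv-inverseʳ c c≢0 ⟩
  1ℚ                 ∎)


^-+ : ∀ q m n → q ^ m * q ^ n ≡ q ^ (m +ℕ n)
^-+ q zero    n = *-identityˡ _
^-+ q (suc m) n = trans (*-assoc q (q ^ m) (q ^ n)) (cong (q *_) (^-+ q m n))

^-odd : ∀ q s → q ^ (2 *ℕ s +ℕ 1) ≡ q * (q ^ s * q ^ s)
^-odd q s = begin
  q ^ (2 *ℕ s +ℕ 1)  ≡⟨ cong (q ^_) (trans (ℕ.+-comm (2 *ℕ s) 1) (cong (λ k → suc (s +ℕ k)) (ℕ.+-identityʳ s))) ⟩
  q * q ^ (s +ℕ s)   ≡⟨ cong (q *_) (sym (^-+ q s s)) ⟩
  q * (q ^ s * q ^ s) ∎

qfac : ℚ → ℕ → ℚ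
qfac q n = poch q q n

poch-split : ∀ q m n → qfac q m * poch (q ^ suc m) q n ≡ qfac q (m +ℕ n)
poch-split q m zero    = trans (*-identityʳ _) (cong (qfac q) (sym (ℕ.+-identityʳ m)))
poch-split q m (suc n) = begin
  qfac q m * (poch (q ^ suc m) q n * (1ℚ - q ^ suc m * q ^ n))
    ≡⟨ sym (*-assoc (qfac q m) _ _) ⟩
  (qfac q m * poch (q ^ suc m) q n) * (1ℚ - q ^ suc m * q ^ n)
    ≡⟨ cong₂ (λ a b → a * (1ℚ - b)) (poch-split q m n) (^-+ q (suc m) n) ⟩
  qfac q (m +ℕ n) * (1ℚ - q ^ suc (m +ℕ n))
    ≡⟨ cong (qfac q) (sym (ℕ.+-suc m n)) ⟩
  qfac q (m +ℕ suc n) ∎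

qfac-nonZero : ∀ q n → (∀ i → 1 ≤ i → i ≤ n → q ^ i ≢ 1ℚ) → qfac q n ≢ 0ℚ
qfac-nonZero q zero    _ = 1≢0
qfac-nonZero q (suc n) h =
  *-nonZero _ _ (qfac-nonZero q n (λ i 1≤i i≤n → h i 1≤i (ℕ.m≤n⇒m≤1+n i≤n)))
                (one-minus-nonZero (q ^ suc n) (h (suc n) (s≤s z≤n) ℕ.≤-refl))

inv-poch-tail : ∀ q t N → t ≤ N → qfac q N ≢ 0ℚ →
  inv (poch (q ^ suc t) q (N ∸ t)) ≡ qfac q t * inv (qfac q N)
inv-poch-tail q t N t≤N nz = inv-via-product (poch (q ^ suc t) q (N ∸ t)) (qfac q t) (qfac q N) split nz
  where
  split : poch (q ^ suc t) q (N ∸ t) * qfac q t ≡ qfac q N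
  split = begin
    poch (q ^ suc t) q (N ∸ t) * qfac q t ≡⟨ *-comm _ (qfac q t) ⟩
    qfac q t * poch (q ^ suc t) q (N ∸ t) ≡⟨ poch-split q t (N ∸ t) ⟩
    qfac q (t +ℕ (N ∸ t))                 ≡⟨ cong (qfac q) (ℕ.m+[n∸m]≡n t≤N) ⟩
    qfac q N                              ∎


sumFrom1-cong : ∀ n (f g : ℕ → ℚ) → (∀ s → 1 ≤ s → s ≤ n → f s ≡ g s) →
  sumFrom1 n f ≡ sumFrom1 n g
sumFrom1-cong zero    f g h = refl
sumFrom1-cong (suc n) f g h =
  cong₂ _+_ (sumFrom1-cong n f g (λ s 1≤s s≤n → h s 1≤s (ℕ.m≤n⇒m≤1+n s≤n)))
            (h (suc n) (s≤s z≤n) ℕ.≤-refl)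

sumFrom1-*ʳ : ∀ n (f : ℕ → ℚ) c → sumFrom1 n (λ s → f s * c) ≡ sumFrom1 n f * c
sumFrom1-*ʳ zero    f c = sym (*-zeroˡ c)
sumFrom1-*ʳ (suc n) f c = trans (cong (_+ f (suc n) * c) (sumFrom1-*ʳ n f c))
  (solve 3 (λ a b c → a :* c :+ b :* c := (a :+ b) :* c) refl (sumFrom1 n f) (f (suc n)) c)


odd-power-sum : ∀ q L →
  sumFrom1 L (λ s → q ^ (2 *ℕ s +ℕ 1) * qfac q (s ∸ 1))
    ≡ ((qfac q (suc L) - q * qfac q L) + (q + q)) - 1ℚ
odd-power-sum q zero = solve 1 (λ q →
  con 0ℚ := ((con 1ℚ :* (con 1ℚ :- q :* con 1ℚ)) :- q :* con 1ℚ :+ (q :+ q)) :- con 1ℚ) refl q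
odd-power-sum q (suc L) = begin
  sumFrom1 L (λ s → q ^ (2 *ℕ s +ℕ 1) * qfac q (s ∸ 1)) + q ^ (2 *ℕ suc L +ℕ 1) * qfac q L
    ≡⟨ cong₂ _+_ (odd-power-sum q L) (cong (_* qfac q L) (^-odd q (suc L))) ⟩
  (((qfac q L * (1ℚ - q * q ^ L) - q * qfac q L) + (q + q)) - 1ℚ)
      + q * ((q * q ^ L) * (q * q ^ L)) * qfac q L
    ≡⟨ solve 3 (λ q x p →
         (((p :* (con 1ℚ :- q :* x) :- q :* p) :+ (q :+ q)) :- con 1ℚ) :+ q :* ((q :* x) :* (q :* x)) :* p
         := ((p :* (con 1ℚ :- q :* x) :* (con 1ℚ :- q :* (q :* x)) :- q :* (p :* (con 1ℚ :- q :* x)))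
              :+ (q :+ q)) :- con 1ℚ)
       refl q (q ^ L) (qfac q L) ⟩
  ((qfac q (suc (suc L)) - q * qfac q (suc L)) + (q + q)) - 1ℚ ∎


-- Each summand of the theorem has denominator (q;q)_(L+1): writing s = t + 1,
-- L + 2 - s = (L + 1) - t, so inv-poch-tail applies.
summand-over-qfac : ∀ q L s → 1 ≤ s → s ≤ L → qfac q (suc L) ≢ 0ℚ →
  q ^ (2 *ℕ s +ℕ 1) * inv (poch (q ^ s) q ((L +ℕ 2) ∸ s))
    ≡ q ^ (2 *ℕ s +ℕ 1) * qfac q (s ∸ 1) * inv (qfac q (suc L))
summand-over-qfac q L (suc t) _ s≤L D≢0 = begin
  q ^ (2 *ℕ suc t +ℕ 1) * inv (poch (q ^ suc t) q ((L +ℕ 2) ∸ suc t))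
    ≡⟨ cong (λ k → q ^ (2 *ℕ suc t +ℕ 1) * inv (poch (q ^ suc t) q (k ∸ suc t))) (ℕ.+-comm L 2) ⟩
  q ^ (2 *ℕ suc t +ℕ 1) * inv (poch (q ^ suc t) q (suc L ∸ t))
    ≡⟨ cong (q ^ (2 *ℕ suc t +ℕ 1) *_) (inv-poch-tail q t (suc L) t≤L+1 D≢0) ⟩
  q ^ (2 *ℕ suc t +ℕ 1) * (qfac q t * inv (qfac q (suc L)))
    ≡⟨ sym (*-assoc (q ^ (2 *ℕ suc t +ℕ 1)) (qfac q t) (inv (qfac q (suc L)))) ⟩
  q ^ (2 *ℕ suc t +ℕ 1) * qfac q t * inv (qfac q (suc L)) ∎
  where
  t≤L+1 : t ≤ suc L
  t≤L+1 = ℕ.m≤n⇒m≤1+n (ℕ.≤-trans (ℕ.n≤1+n t) s≤L)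

theorem4p2 : (L : ℕ) → 1 ≤ L → (q : ℚ) → (∀ i → 1 ≤ i → i ≤ suc L → q ^ i ≢ 1ℚ) →
    sumFrom1 L (λ s → (q ^ (2 *ℕ s +ℕ 1)) ÷ poch (q ^ s) q ((L +ℕ 2) ∸ s))
      ≡ (1ℚ - q ÷ (1ℚ - q ^ suc L)) + (((q + q) - 1ℚ) ÷ poch q q (suc L))
theorem4p2 L _ q h = begin
  sumFrom1 L (λ s → q ^ (2 *ℕ s +ℕ 1) * inv (poch (q ^ s) q ((L +ℕ 2) ∸ s)))
    ≡⟨ sumFrom1-cong L _ _ (λ s 1≤s s≤L → summand-over-qfac q L s 1≤s s≤L D≢0) ⟩
  sumFrom1 L (λ s → q ^ (2 *ℕ s +ℕ 1) * qfac q (s ∸ 1) * 1/D)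
    ≡⟨ sumFrom1-*ʳ L _ 1/D ⟩
  sumFrom1 L (λ s → q ^ (2 *ℕ s +ℕ 1) * qfac q (s ∸ 1)) * 1/D
    ≡⟨ cong (_* 1/D) (odd-power-sum q L) ⟩
  (((D - q * qfac q L) + (q + q)) - 1ℚ) * 1/D
    ≡⟨ solve 4 (λ q d p i → (((d :- q :* p) :+ (q :+ q)) :- con 1ℚ) :* i
                            := d :* i :- q :* (p :* i) :+ ((q :+ q) :- con 1ℚ) :* i)
             refl q D (qfac q L) 1/D ⟩
  D * 1/D - q * (qfac q L * 1/D) + ((q + q) - 1ℚ) * 1/D
    ≡⟨ cong₂ (λ a b → a - q * b + ((q + q) - 1ℚ) * 1/D) (inv-inverseʳ D D≢0) (sym last-factor) ⟩
  1ℚ - q * inv (1ℚ - q ^ suc L) + ((q + q) - 1ℚ) * 1/D ∎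
  where
  D : ℚ
  D = qfac q (suc L)

  1/D : ℚ
  1/D = inv D

  D≢0 : D ≢ 0ℚ
  D≢0 = qfac-nonZero q (suc L) h

  last-factor : inv (1ℚ - q ^ suc L) ≡ qfac q L * 1/D
  last-factor = inv-via-product (1ℚ - q ^ suc L) (qfac q L) D (*-comm _ (qfac q L)) D≢0
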